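{- Let $F$ be a non-archimedean ordered field, $\mathcal{C}$ the set of all convex subgroups of $(F,+)$, and $Q=\{a+A: a\in F, A\in\mathcal{C}\}$. For all $\alpha,\beta\in Q$ there exists $\delta\in Q$ such that $e(\alpha)\beta=e(\delta)$.
   Context: A subset of $F$ is convex if it contains every element lying between two of its elements. Each $\alpha\in Q$ can be written $\alpha=a+A$ with $A\in\mathcal{C}$ uniquely determined; $e(\alpha):=A$. Multiplication on $Q$: $(a+A)(b+B)=ab+aB+bA+AB$ with elementwise sums and products of sets (independent of representatives); a magnitude $A$ is regarded as the element $0+A$ of $Q$. -}

module Defs where

open import Data.Nat using (ℕ; zero; suc)
open import Data.Product using (Σ; ∃; ∃₂; _×_; _,_)
open import Data.Sum using (_⊎_)
open import Relation.Nullary using (¬_)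
open import Relation.Binary.PropositionalEquality using (_≡_)
open import Algebra.Structures using (IsCommutativeRing)

record OrderedField : Set₁ where
  infixl 6 _+_
  infixl 7 _*_
  infix 4 _<_
  field
    F    : Set
    _+_  : F → F → F
    _*_  : F → F → F
    -_   : F → F
    0#   : F
    1#   : F
    _<_  : F → F → Set
    isCommutativeRing : IsCommutativeRing _≡_ _+_ _*_ -_ 0# 1#
    0≢1  : ¬ (0# ≡ 1#)
    inverse : ∀ x → ¬ (x ≡ 0#) → ∃ λ y → x * y ≡ 1#
    <-irrefl : ∀ x → ¬ (x < x)
    <-trans  : ∀ {x y z} → x < y → y < z → x < z
    trichotomy : ∀ x y → (x < y) ⊎ (x ≡ y) ⊎ (y < x)
    +-mono-<  : ∀ {x y} z → x < y → x + z < y + z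
    *-pos     : ∀ {x y} → 0# < x → 0# < y → 0# < x * y

  _≤_ : F → F → Set
  x ≤ y = (x < y) ⊎ (x ≡ y)

  fromℕ : ℕ → F
  fromℕ zero    = 0#
  fromℕ (suc n) = 1# + fromℕ n

NonArchimedean : OrderedField → Set
NonArchimedean 𝔽 = ∃ λ x → ∀ (n : ℕ) → fromℕ n < x
  where open OrderedField 𝔽

module Over (𝔽 : OrderedField) where
  open OrderedField 𝔽

  Pred : Set₁
  Pred = F → Set

  _≐_ : Pred → Pred → Set
  A ≐ B = ∀ x → (A x → B x) × (B x → A x)

  ｛_｝ : F → Pred
  ｛ a ｝ = λ z → z ≡ a

  infixl 6 _⊕_
  infixl 7 _⊗_
  _⊕_ : Pred → Pred → Pred
  A ⊕ B = λ z → ∃₂ λ x y → A x × B y × (z ≡ x + y)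

  _⊗_ : Pred → Pred → Pred
  A ⊗ B = λ z → ∃₂ λ x y → A x × B y × (z ≡ x * y)

  IsConvex : Pred → Set
  IsConvex A = ∀ x y z → A x → A z → x ≤ y → y ≤ z → A y

  IsSubgroup : Pred → Set
  IsSubgroup A = A 0# × (∀ x y → A x → A y → A (x + y)) × (∀ x → A x → A (- x))

  record ConvexSubgroup : Set₁ where
    field
      set      : Pred
      subgroup : IsSubgroup set
      convex   : IsConvex set

  -- an element of Q, given by a representative a and a magnitude A, denoting a + A
  record Q : Set₁ where
    constructor _+ᴬ_
    field
      rep : F
      mag : ConvexSubgroup

  ⟦_⟧ : Q → Pred
  ⟦ a +ᴬ A ⟧ = ｛ a ｝ ⊕ ConvexSubgroup.set A

  e : Q → ConvexSubgroup
  e = Q.mag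

  mag→Q : ConvexSubgroup → Q
  mag→Q A = 0# +ᴬ A

  -- (a+A)(b+B) = ab + aB + bA + AB, as a subset of F
  mulSet : Q → Q → Pred
  mulSet (a +ᴬ A) (b +ᴬ B) =
    (｛ a ｝ ⊗ ｛ b ｝) ⊕ (｛ a ｝ ⊗ ConvexSubgroup.set B)
      ⊕ (｛ b ｝ ⊗ ConvexSubgroup.set A) ⊕ (ConvexSubgroup.set A ⊗ ConvexSubgroup.set B)

module Submission where

-- The product is the set  bA + AB.  Call a set S ⊆ F a *solid
-- doubling set* if it is inhabited, solid (|z| ≤ |s| and s ∈ S give z ∈ S)
-- and closed under s ↦ s + s.  Every such set is a convex subgroup:
-- 0 and negatives are absorbed by solidity, and since
-- |u + v| ≤ |u + u| or |u + v| ≤ |v + v|, closure under doubling yields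
-- closure under addition.  Convex subgroups are themselves solid, hence
--   * P·C is a solid doubling set for any inhabited P and convex subgroup C
--     (|z| ≤ |p c| with p ≠ 0 gives z = p (p⁻¹ z) with |p⁻¹ z| ≤ |c|), and
--   * the sum of two solid doubling sets is a solid doubling set.
-- So D = bA + AB is a convex subgroup and e(α)β = 0 + D.

open import Defs
open import Data.Product using (∃; _×_; _,_; proj₁; proj₂)
open import Data.Sum using (_⊎_; inj₁; inj₂; [_,_]′)
open import Data.Empty using (⊥-elim)
open import Relation.Binary.PropositionalEquality
  using (_≡_; refl; sym; trans; cong; cong₂; subst; subst₂; resp₂; isEquivalence; module ≡-Reasoning)
open import Algebra.Bundles using (CommutativeRing)
import Algebra.Properties.Ring as RingProperties
import Algebra.Properties.CommutativeSemigroup as CommutativeSemigroupProperties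
import Relation.Binary.Construct.StrictToNonStrict as StrictToNonStrict

module OrderedFieldFacts (𝔽 : OrderedField) where
  open OrderedField 𝔽 renaming (_≤_ to infix 4 _≤_)

  commutativeRing : CommutativeRing _ _
  commutativeRing = record { isCommutativeRing = isCommutativeRing }

  open CommutativeRing commutativeRing public
    using ( +-assoc; +-comm; +-identityˡ; +-identityʳ; -‿inverseˡ; -‿inverseʳ
          ; *-comm; *-assoc; *-identityʳ; zeroˡ; zeroʳ; distribˡ; distribʳ )
  open RingProperties (CommutativeRing.ring commutativeRing) public
    using (-‿distribˡ-*; -‿distribʳ-*; -0#≈0#; -‿involutive; -‿+-comm)
  open CommutativeSemigroupProperties (CommutativeRing.+-commutativeSemigroup commutativeRing) public
    using (interchange)
  open ≡-Reasoning

  +-cancel-neg : ∀ x z → x + (- x + z) ≡ z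
  +-cancel-neg x z = begin
    x + (- x + z)  ≡⟨ +-assoc x (- x) z ⟨
    x + - x + z    ≡⟨ cong (_+ z) (-‿inverseʳ x) ⟩
    0# + z         ≡⟨ +-identityˡ z ⟩
    z              ∎

  neg-*-neg : ∀ x y → - x * - y ≡ x * y
  neg-*-neg x y = begin
    - x * - y      ≡⟨ -‿distribˡ-* x (- y) ⟨
    - (x * - y)    ≡⟨ cong -_ (-‿distribʳ-* x y) ⟨
    - - (x * y)    ≡⟨ -‿involutive (x * y) ⟩
    x * y          ∎

  ≤-refl : ∀ {x} → x ≤ x
  ≤-refl = inj₂ refl

  ≤-trans : ∀ {x y z} → x ≤ y → y ≤ z → x ≤ z
  ≤-trans = StrictToNonStrict.trans _≡_ _<_ isEquivalence (resp₂ _<_) <-trans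

  ≤-<-trans : ∀ {x y z} → x ≤ y → y < z → x < z
  ≤-<-trans = StrictToNonStrict.≤-<-trans _≡_ _<_ sym <-trans (proj₂ (resp₂ _<_))

  ≤-antisym : ∀ {x y} → x ≤ y → y ≤ x → x ≡ y
  ≤-antisym = StrictToNonStrict.antisym _≡_ _<_ isEquivalence <-trans (λ { refl → <-irrefl _ })

  ≤-total : ∀ x y → x ≤ y ⊎ y ≤ x
  ≤-total x y with trichotomy x y
  ... | inj₁ x<y         = inj₁ (inj₁ x<y)
  ... | inj₂ (inj₁ x≡y)  = inj₁ (inj₂ x≡y)
  ... | inj₂ (inj₂ y<x)  = inj₂ (inj₁ y<x)

  +-monoˡ-≤ : ∀ {x y} z → x ≤ y → x + z ≤ y + z
  +-monoˡ-≤ z (inj₁ x<y)  = inj₁ (+-mono-< z x<y)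
  +-monoˡ-≤ z (inj₂ refl) = ≤-refl

  +-mono-≤ : ∀ {a b c d} → a ≤ b → c ≤ d → a + c ≤ b + d
  +-mono-≤ {a} {b} {c} {d} a≤b c≤d = ≤-trans (+-monoˡ-≤ c a≤b) (subst₂ _≤_ (+-comm c b) (+-comm d b) (+-monoˡ-≤ b c≤d))

  -- Adding - x + - y to both sides of x < y gives - y < - x.
  neg-antimono-≤ : ∀ {x y} → x ≤ y → - y ≤ - x
  neg-antimono-≤ {x} {y} x≤y = subst₂ _≤_ (+-cancel-neg x (- y)) y+[-x+-y]≡-x (+-monoˡ-≤ (- x + - y) x≤y)
    where
    y+[-x+-y]≡-x : y + (- x + - y) ≡ - x
    y+[-x+-y]≡-x = trans (cong (y +_) (+-comm (- x) (- y))) (+-cancel-neg y (- x))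

  nonneg⇒neg-nonpos : ∀ {x} → 0# ≤ x → - x ≤ 0#
  nonneg⇒neg-nonpos 0≤x = subst (_ ≤_) -0#≈0# (neg-antimono-≤ 0≤x)

  nonpos⇒neg-nonneg : ∀ {x} → x ≤ 0# → 0# ≤ - x
  nonpos⇒neg-nonneg x≤0 = subst (_≤ _) -0#≈0# (neg-antimono-≤ x≤0)

  neg-nonneg⇒nonpos : ∀ {x} → 0# ≤ - x → x ≤ 0#
  neg-nonneg⇒nonpos {x} 0≤-x = subst (_≤ 0#) (-‿involutive x) (nonneg⇒neg-nonpos 0≤-x)

  *-nonneg : ∀ {x y} → 0# ≤ x → 0# ≤ y → 0# ≤ x * y
  *-nonneg         (inj₁ 0<x)  (inj₁ 0<y)  = inj₁ (*-pos 0<x 0<y)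
  *-nonneg {x}     (inj₁ _)    (inj₂ refl) = inj₂ (sym (zeroʳ x))
  *-nonneg {_} {y} (inj₂ refl) _           = inj₂ (sym (zeroˡ y))

  *-nonneg-nonpos : ∀ {x y} → 0# ≤ x → y ≤ 0# → x * y ≤ 0#
  *-nonneg-nonpos {x} {y} 0≤x y≤0 =
    neg-nonneg⇒nonpos (subst (0# ≤_) (sym (-‿distribʳ-* x y)) (*-nonneg 0≤x (nonpos⇒neg-nonneg y≤0)))

  *-monoˡ-≤ : ∀ {a b c} → a ≤ b → 0# ≤ c → a * c ≤ b * c
  *-monoˡ-≤ {a} {b} {c} a≤b 0≤c =
    subst₂ _≤_ (+-identityˡ (a * c)) [b-a]c+ac≡bc (+-monoˡ-≤ (a * c) (*-nonneg 0≤b-a 0≤c))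
    where
    0≤b-a : 0# ≤ b + - a
    0≤b-a = subst (_≤ b + - a) (-‿inverseʳ a) (+-monoˡ-≤ (- a) a≤b)
    [b-a]c+ac≡bc : (b + - a) * c + a * c ≡ b * c
    [b-a]c+ac≡bc = begin
      (b + - a) * c + a * c  ≡⟨ distribʳ c (b + - a) a ⟨
      (b + - a + a) * c      ≡⟨ cong (_* c) (+-assoc b (- a) a) ⟩
      (b + (- a + a)) * c    ≡⟨ cong (λ t → (b + t) * c) (-‿inverseˡ a) ⟩
      (b + 0#) * c           ≡⟨ cong (_* c) (+-identityʳ b) ⟩
      b * c                  ∎

  zero-or-invertible : ∀ x → x ≡ 0# ⊎ ∃ λ y → x * y ≡ 1#
  zero-or-invertible x with trichotomy x 0#
  ... | inj₁ x<0         = inj₂ (inverse x (λ { refl → <-irrefl _ x<0 }))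
  ... | inj₂ (inj₁ x≡0)  = inj₁ x≡0
  ... | inj₂ (inj₂ 0<x)  = inj₂ (inverse x (λ { refl → <-irrefl _ 0<x }))

  sign : ∀ x → 0# ≤ x ⊎ x < 0#
  sign x with trichotomy 0# x
  ... | inj₁ 0<x         = inj₁ (inj₁ 0<x)
  ... | inj₂ (inj₁ 0≡x)  = inj₁ (inj₂ 0≡x)
  ... | inj₂ (inj₂ x<0)  = inj₂ x<0

  ∣_∣ : F → F
  ∣ x ∣ with sign x
  ... | inj₁ _ = x
  ... | inj₂ _ = - x

  abs-cases : ∀ x → (0# ≤ x × ∣ x ∣ ≡ x) ⊎ (x ≤ 0# × ∣ x ∣ ≡ - x)
  abs-cases x with sign x
  ... | inj₁ 0≤x = inj₁ (0≤x , refl)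
  ... | inj₂ x<0 = inj₂ (inj₁ x<0 , refl)

  abs-nonneg : ∀ {x} → 0# ≤ x → ∣ x ∣ ≡ x
  abs-nonneg {x} 0≤x with sign x
  ... | inj₁ _   = refl
  ... | inj₂ x<0 = ⊥-elim (<-irrefl _ (≤-<-trans 0≤x x<0))

  abs-nonpos : ∀ {x} → x ≤ 0# → ∣ x ∣ ≡ - x
  abs-nonpos {x} x≤0 with sign x
  ... | inj₂ _   = refl
  ... | inj₁ 0≤x with ≤-antisym x≤0 0≤x
  ...   | refl = sym -0#≈0#

  abs-0 : ∣ 0# ∣ ≡ 0#
  abs-0 = abs-nonneg ≤-refl

  abs-nonneg-self : ∀ x → 0# ≤ ∣ x ∣
  abs-nonneg-self x with abs-cases x
  ... | inj₁ (0≤x , ∣x∣≡x)  = subst (0# ≤_) (sym ∣x∣≡x) 0≤x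
  ... | inj₂ (x≤0 , ∣x∣≡-x) = subst (0# ≤_) (sym ∣x∣≡-x) (nonpos⇒neg-nonneg x≤0)

  ≤-abs : ∀ x → x ≤ ∣ x ∣
  ≤-abs x with abs-cases x
  ... | inj₁ (_ , ∣x∣≡x)   = inj₂ (sym ∣x∣≡x)
  ... | inj₂ (x≤0 , _)     = ≤-trans x≤0 (abs-nonneg-self x)

  neg-≤-abs : ∀ x → - x ≤ ∣ x ∣
  neg-≤-abs x with abs-cases x
  ... | inj₁ (0≤x , _)     = ≤-trans (nonneg⇒neg-nonpos 0≤x) (abs-nonneg-self x)
  ... | inj₂ (_ , ∣x∣≡-x)  = inj₂ (sym ∣x∣≡-x)

  abs-least : ∀ {x t} → x ≤ t → - x ≤ t → ∣ x ∣ ≤ t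
  abs-least {x} x≤t -x≤t with abs-cases x
  ... | inj₁ (_ , ∣x∣≡x)  = subst (_≤ _) (sym ∣x∣≡x) x≤t
  ... | inj₂ (_ , ∣x∣≡-x) = subst (_≤ _) (sym ∣x∣≡-x) -x≤t

  abs-bounds : ∀ {z t} → ∣ z ∣ ≤ t → - t ≤ z × z ≤ t
  abs-bounds {z} ∣z∣≤t =
    subst (_ ≤_) (-‿involutive z) (neg-antimono-≤ (≤-trans (neg-≤-abs z) ∣z∣≤t)) , ≤-trans (≤-abs z) ∣z∣≤t

  abs-neg-≤ : ∀ x → ∣ - x ∣ ≤ ∣ x ∣
  abs-neg-≤ x = abs-least (neg-≤-abs x) (subst (_≤ ∣ x ∣) (sym (-‿involutive x)) (≤-abs x))

  abs-zero : ∀ {z} → ∣ z ∣ ≤ ∣ 0# ∣ → z ≡ 0#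
  abs-zero {z} ∣z∣≤∣0∣ = [ (λ (_ , ∣z∣≡z) → trans (sym ∣z∣≡z) ∣z∣≡0) , from-negative ]′ (abs-cases z)
    where
    ∣z∣≡0 : ∣ z ∣ ≡ 0#
    ∣z∣≡0 = ≤-antisym (subst (∣ z ∣ ≤_) abs-0 ∣z∣≤∣0∣) (abs-nonneg-self z)
    from-negative : z ≤ 0# × ∣ z ∣ ≡ - z → z ≡ 0#
    from-negative (_ , ∣z∣≡-z) = begin
      z        ≡⟨ -‿involutive z ⟨
      - - z    ≡⟨ cong -_ (trans (sym ∣z∣≡-z) ∣z∣≡0) ⟩
      - 0#     ≡⟨ -0#≈0# ⟩
      0#       ∎

  abs-* : ∀ x y → ∣ x * y ∣ ≡ ∣ x ∣ * ∣ y ∣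
  abs-* x y with abs-cases x | abs-cases y
  ... | inj₁ (0≤x , ex) | inj₁ (0≤y , ey) =
    trans (abs-nonneg (*-nonneg 0≤x 0≤y)) (sym (cong₂ _*_ ex ey))
  ... | inj₁ (0≤x , ex) | inj₂ (y≤0 , ey) =
    trans (abs-nonpos (*-nonneg-nonpos 0≤x y≤0)) (trans (-‿distribʳ-* x y) (sym (cong₂ _*_ ex ey)))
  ... | inj₂ (x≤0 , ex) | inj₁ (0≤y , ey) =
    trans (abs-nonpos (subst (_≤ 0#) (*-comm y x) (*-nonneg-nonpos 0≤y x≤0)))
          (trans (-‿distribˡ-* x y) (sym (cong₂ _*_ ex ey)))
  ... | inj₂ (x≤0 , ex) | inj₂ (y≤0 , ey) =
    trans (abs-nonneg (subst (0# ≤_) (neg-*-neg x y) (*-nonneg (nonpos⇒neg-nonneg x≤0) (nonpos⇒neg-nonneg y≤0))))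
          (trans (sym (neg-*-neg x y)) (sym (cong₂ _*_ ex ey)))

  abs-triangle : ∀ u v → ∣ u + v ∣ ≤ ∣ u ∣ + ∣ v ∣
  abs-triangle u v = abs-least (+-mono-≤ (≤-abs u) (≤-abs v))
    (subst (_≤ ∣ u ∣ + ∣ v ∣) (-‿+-comm u v) (+-mono-≤ (neg-≤-abs u) (neg-≤-abs v)))

  abs-double : ∀ u → ∣ u + u ∣ ≡ ∣ u ∣ + ∣ u ∣
  abs-double u with abs-cases u
  ... | inj₁ (0≤u , e) =
    trans (abs-nonneg (subst (_≤ u + u) (+-identityˡ 0#) (+-mono-≤ 0≤u 0≤u))) (sym (cong₂ _+_ e e))
  ... | inj₂ (u≤0 , e) =
    trans (abs-nonpos (subst (u + u ≤_) (+-identityˡ 0#) (+-mono-≤ u≤0 u≤0)))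
          (trans (sym (-‿+-comm u u)) (sym (cong₂ _+_ e e)))

  abs-sum-dominated : ∀ {z} u v → ∣ z ∣ ≤ ∣ u + v ∣ → ∣ z ∣ ≤ ∣ u + u ∣ ⊎ ∣ z ∣ ≤ ∣ v + v ∣
  abs-sum-dominated {z} u v ∣z∣≤∣u+v∣ with ≤-total ∣ v ∣ ∣ u ∣
  ... | inj₁ ∣v∣≤∣u∣ = inj₁ (≤-trans ∣z∣≤∣u+v∣ (≤-trans (abs-triangle u v)
          (subst (∣ u ∣ + ∣ v ∣ ≤_) (sym (abs-double u)) (+-mono-≤ ≤-refl ∣v∣≤∣u∣))))
  ... | inj₂ ∣u∣≤∣v∣ = inj₂ (≤-trans ∣z∣≤∣u+v∣ (≤-trans (abs-triangle u v)
          (subst (∣ u ∣ + ∣ v ∣ ≤_) (sym (abs-double v)) (+-mono-≤ ∣u∣≤∣v∣ ≤-refl))))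

  abs-between : ∀ {s₁ t s₂} → s₁ ≤ t → t ≤ s₂ → ∣ t ∣ ≤ ∣ s₁ ∣ ⊎ ∣ t ∣ ≤ ∣ s₂ ∣
  abs-between {s₁} {t} {s₂} s₁≤t t≤s₂ with ≤-total 0# t
  ... | inj₁ 0≤t = inj₂ (subst₂ _≤_ (sym (abs-nonneg 0≤t)) (sym (abs-nonneg (≤-trans 0≤t t≤s₂))) t≤s₂)
  ... | inj₂ t≤0 = inj₁ (subst₂ _≤_ (sym (abs-nonpos t≤0)) (sym (abs-nonpos (≤-trans s₁≤t t≤0))) (neg-antimono-≤ s₁≤t))

  abs-divide : ∀ {p q c z} → p * q ≡ 1# → ∣ z ∣ ≤ ∣ p * c ∣ → ∣ q * z ∣ ≤ ∣ c ∣
  abs-divide {p} {q} {c} {z} pq≡1 ∣z∣≤∣pc∣ =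
    subst₂ _≤_ (sym (abs-* q z)) (trans (sym (abs-* q (p * c))) (cong ∣_∣ q[pc]≡c))
      (subst₂ _≤_ (*-comm ∣ z ∣ ∣ q ∣) (*-comm ∣ p * c ∣ ∣ q ∣) (*-monoˡ-≤ ∣z∣≤∣pc∣ (abs-nonneg-self q)))
    where
    q[pc]≡c : q * (p * c) ≡ c
    q[pc]≡c = begin
      q * (p * c)   ≡⟨ *-assoc q p c ⟨
      q * p * c     ≡⟨ cong (_* c) (trans (*-comm q p) pq≡1) ⟩
      1# * c        ≡⟨ *-comm 1# c ⟩
      c * 1#        ≡⟨ *-identityʳ c ⟩
      c             ∎

module Magnitudes (𝔽 : OrderedField) where
  open OrderedField 𝔽 using (F; _+_; _*_; -_; 0#; 1#) renaming (_≤_ to infix 4 _≤_)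
  open OrderedFieldFacts 𝔽
  open Over 𝔽 renaming (_≐_ to infix 4 _≐_)
  open ConvexSubgroup

  Solid : Pred → Set
  Solid S = ∀ {s z} → S s → ∣ z ∣ ≤ ∣ s ∣ → S z

  -- An inhabited solid set closed under doubling; these are exactly the
  -- convex subgroups (see toConvexSubgroup and convexSubgroup-solid).
  record SolidDoubling (S : Pred) : Set where
    field
      inhabited : ∃ S
      solid     : Solid S
      doubling  : ∀ {s} → S s → S (s + s)

  toConvexSubgroup : ∀ {S} → SolidDoubling S → ConvexSubgroup
  toConvexSubgroup {S} sd = record
    { set      = S
    ; subgroup = has-0 , (λ _ _ → has-+) , (λ _ Ss → solid Ss (abs-neg-≤ _))
    ; convex   = λ _ _ _ Sx Sz x≤y y≤z → [ solid Sx , solid Sz ]′ (abs-between x≤y y≤z)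
    }
    where
    open SolidDoubling sd
    has-0 : S 0#
    has-0 = solid (proj₂ inhabited) (subst (_≤ ∣ proj₁ inhabited ∣) (sym abs-0) (abs-nonneg-self (proj₁ inhabited)))
    has-+ : ∀ {u v} → S u → S v → S (u + v)
    has-+ {u} {v} Su Sv = [ solid (doubling Su) , solid (doubling Sv) ]′ (abs-sum-dominated u v ≤-refl)

  convexSubgroup-solid : (C : ConvexSubgroup) → Solid (set C)
  convexSubgroup-solid C {w} {z} Cw ∣z∣≤∣w∣ = convex C (- ∣ w ∣) z ∣ w ∣ (neg-closed C∣w∣) C∣w∣ -∣w∣≤z z≤∣w∣
    where
    neg-closed : ∀ {x} → set C x → set C (- x)
    neg-closed = proj₂ (proj₂ (subgroup C)) _
    C∣w∣ : set C ∣ w ∣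
    C∣w∣ with abs-cases w
    ... | inj₁ (_ , e) = subst (set C) (sym e) Cw
    ... | inj₂ (_ , e) = subst (set C) (sym e) (neg-closed Cw)
    -∣w∣≤z : (- ∣ w ∣) ≤ z
    -∣w∣≤z = proj₁ (abs-bounds ∣z∣≤∣w∣)
    z≤∣w∣ : z ≤ ∣ w ∣
    z≤∣w∣ = proj₂ (abs-bounds ∣z∣≤∣w∣)

  product-solidDoubling : ∀ {P} → ∃ P → (C : ConvexSubgroup) → SolidDoubling (P ⊗ set C)
  product-solidDoubling {P} (p₀ , Pp₀) C = record
    { inhabited = p₀ * 0# , p₀ , 0# , Pp₀ , C0 , refl
    ; solid     = absorb
    ; doubling  = λ { (p , c , Pp , Cc , refl) → p , c + c , Pp , C+ Cc Cc , sym (distribˡ p c c) }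
    }
    where
    C0 : set C 0#
    C0 = proj₁ (subgroup C)
    C+ : ∀ {x y} → set C x → set C y → set C (x + y)
    C+ = proj₁ (proj₂ (subgroup C)) _ _
    -- ∣ z ∣ ≤ ∣ p c ∣: either p = 0 and z = 0 = p 0, or z = p (p⁻¹ z) with p⁻¹ z ∈ C.
    absorb : Solid (P ⊗ set C)
    absorb {z = z} (p , c , Pp , Cc , refl) ∣z∣≤∣pc∣ with zero-or-invertible p
    ... | inj₁ refl = 0# , 0# , Pp , C0 ,
      trans (abs-zero (subst (λ t → ∣ z ∣ ≤ ∣ t ∣) (zeroˡ c) ∣z∣≤∣pc∣)) (sym (zeroˡ 0#))
    ... | inj₂ (q , pq≡1) = p , q * z , Pp , convexSubgroup-solid C Cc (abs-divide pq≡1 ∣z∣≤∣pc∣) , p[qz]≡z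
      where
      open ≡-Reasoning
      p[qz]≡z : z ≡ p * (q * z)
      p[qz]≡z = sym (begin
        p * (q * z)   ≡⟨ *-assoc p q z ⟨
        p * q * z     ≡⟨ cong (_* z) pq≡1 ⟩
        1# * z        ≡⟨ *-comm 1# z ⟩
        z * 1#        ≡⟨ *-identityʳ z ⟩
        z             ∎)

  sum-solidDoubling : ∀ {S T} → SolidDoubling S → SolidDoubling T → SolidDoubling (S ⊕ T)
  sum-solidDoubling {S} {T} sdS sdT = record
    { inhabited = _ , proj₁ (inhabited sdS) , proj₁ (inhabited sdT) , proj₂ (inhabited sdS) , proj₂ (inhabited sdT) , refl
    ; solid     = absorb
    ; doubling  = λ { (s , t , Ss , Tt , refl) →
                      s + s , t + t , doubling sdS Ss , doubling sdT Tt , interchange s t s t }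
    }
    where
    open SolidDoubling
    S0 : S 0#
    S0 = proj₁ (subgroup (toConvexSubgroup sdS))
    T0 : T 0#
    T0 = proj₁ (subgroup (toConvexSubgroup sdT))
    -- ∣ z ∣ ≤ ∣ s + t ∣ puts z in S (as z + 0) or in T (as 0 + z).
    absorb : Solid (S ⊕ T)
    absorb {z = z} (s , t , Ss , Tt , refl) ∣z∣≤∣s+t∣ with abs-sum-dominated s t ∣z∣≤∣s+t∣
    ... | inj₁ ∣z∣≤∣2s∣ = z , 0# , solid sdS (doubling sdS Ss) ∣z∣≤∣2s∣ , T0 , sym (+-identityʳ z)
    ... | inj₂ ∣z∣≤∣2t∣ = 0# , z , S0 , solid sdT (doubling sdT Tt) ∣z∣≤∣2t∣ , sym (+-identityˡ z)

  ≐-trans : ∀ {A B C} → A ≐ B → B ≐ C → A ≐ C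
  ≐-trans A≐B B≐C x = (λ Ax → proj₁ (B≐C x) (proj₁ (A≐B x) Ax)) , (λ Cx → proj₂ (A≐B x) (proj₂ (B≐C x) Cx))

  ≐-sym : ∀ {A B} → A ≐ B → B ≐ A
  ≐-sym A≐B x = proj₂ (A≐B x) , proj₁ (A≐B x)

  ⊕-congʳ : ∀ {A A′} B → A ≐ A′ → A ⊕ B ≐ A′ ⊕ B
  ⊕-congʳ B A≐A′ _ = (λ { (a , b , Aa , Bb , eq) → a , b , proj₁ (A≐A′ a) Aa , Bb , eq })
                   , (λ { (a , b , Aa , Bb , eq) → a , b , proj₂ (A≐A′ a) Aa , Bb , eq })

  ⊕-identityˡ : ∀ A → ｛ 0# ｝ ⊕ A ≐ A
  ⊕-identityˡ A z = (λ { (_ , a , refl , Aa , refl) → subst A (sym (+-identityˡ a)) Aa })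
                  , (λ Az → 0# , z , refl , Az , sym (+-identityˡ z))

  ⊗-zeroˡ : ∀ {A} → ∃ A → ｛ 0# ｝ ⊗ A ≐ ｛ 0# ｝
  ⊗-zeroˡ (a , Aa) _ = (λ { (_ , x , refl , _ , refl) → zeroˡ x }) , (λ { refl → 0# , a , refl , Aa , sym (zeroˡ a) })

  -- (0 + A)(b + B) = 0·b + 0·B + bA + AB  is the set  bA + AB.
  magnitude-times : (A : ConvexSubgroup) (b : F) (B : ConvexSubgroup) →
    mulSet (0# +ᴬ A) (b +ᴬ B) ≐ (｛ b ｝ ⊗ set A) ⊕ (set A ⊗ set B)
  magnitude-times A b B =
    ⊕-congʳ (set A ⊗ set B)
      (≐-trans (⊕-congʳ (｛ b ｝ ⊗ set A) zero-terms) (⊕-identityˡ (｛ b ｝ ⊗ set A)))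
    where
    B0 : set B 0#
    B0 = proj₁ (subgroup B)
    zero-terms : (｛ 0# ｝ ⊗ ｛ b ｝) ⊕ (｛ 0# ｝ ⊗ set B) ≐ ｛ 0# ｝
    zero-terms = ≐-trans (⊕-congʳ (｛ 0# ｝ ⊗ set B) (⊗-zeroˡ (b , refl)))
                   (≐-trans (⊕-identityˡ (｛ 0# ｝ ⊗ set B)) (⊗-zeroˡ (0# , B0)))

proposition4p3 : (𝔽 : OrderedField) → NonArchimedean 𝔽 →
    (α β : Over.Q 𝔽) →
    ∃ λ (δ : Over.Q 𝔽) →
    Over._≐_ 𝔽 (Over.mulSet 𝔽 (Over.mag→Q 𝔽 (Over.e 𝔽 α)) β)
    (Over.⟦_⟧ 𝔽 (Over.mag→Q 𝔽 (Over.e 𝔽 δ)))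
proposition4p3 𝔽 _ record { mag = A } record { rep = b ; mag = B } =
  0# +ᴬ D , ≐-trans (magnitude-times A b B) (≐-sym (⊕-identityˡ (set D)))
  where
  open OrderedField 𝔽 using (0#)
  open Over 𝔽
  open ConvexSubgroup using (set; subgroup)
  open Magnitudes 𝔽
  D : ConvexSubgroup
  D = toConvexSubgroup (sum-solidDoubling (product-solidDoubling (b , refl) A)
                                           (product-solidDoubling (0# , proj₁ (subgroup A)) B))
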